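{- Consider the median-querying Bayesian graph search process described in the context, with initial weights satisfying $\omega_0(V)=1$. Then for every $\tau\ge0$ (and every sequence of replies), $$\omega_\tau(V\setminus\{x_\tau\})\le\frac{1}{2^\tau},$$ where $x_\tau$ is a heaviest vertex at step $\tau$, i.e. $\omega_\tau(x_\tau)\ge\omega_\tau(u)$ for all $u\in V$ (ties broken arbitrarily).
   Context: $G=(V,E)$ is a connected undirected unweighted graph, $d(u,v)$ its graph distance, and $0<p<\frac12$. The target $v^*$ is unknown; querying $q$ gives either a yes-answer ("$q$ is the target") or a no-answer giving a neighbor $u$ of $q$; each reply is independently erroneous with probability $p$ (a correct no-answer gives a neighbor on a shortest $q$–$v^*$ path). The process maintains nonnegative weights $\omega_t(v)$ ($\omega_t$ = weights after step $t$), $\omega(U)=\sum_{u\in U}\omega(u)$. A vertex $v$ is heavy if $\omega(v)/\omega(V)\ge\frac12$. In each step the process queries a median $q=\arg\min_{v\in V}\sum_{u\in V}d(u,v)\omega(u)$ of the current weights and performs a Bayesian update: each vertex compatible with the reply has its weight multiplied by $1-p$, every other vertex by $p$. Compatibility: for a yes-answer only $v=q$ is compatible; for a no-answer with neighbor $u$, if $q$ is not heavy then $v$ is compatible iff $u$ lies on a shortest $q$–$v$ path, while if $q$ is heavy no vertex is compatible.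
   Formalization: The error probability p and the weights ω_t take rational values. -}

module Defs where

open import Data.Nat as ℕ using (ℕ; zero; suc)
open import Data.Fin using (Fin; _≟_)
open import Data.List using (List; foldr)
open import Data.Fin.Base using ()
open import Data.List.Base using ()
open import Data.Integer using (+_)
open import Data.Rational using (ℚ; 0ℚ; 1ℚ; ½; _+_; _*_; _-_; _≤_; _<_; _/_)
open import Data.Product using (Σ; _×_; ∃)
open import Data.Maybe using (Maybe; just; nothing)
open import Relation.Binary.PropositionalEquality using (_≡_)
open import Relation.Nullary using (¬_; yes; no)
open import Relation.Nullary.Decidable using (⌊_⌋)
open import Data.Bool using (if_then_else_)
import Data.List
open import Data.Unit using (⊤)

Σᵥ : {n : ℕ} → (Fin n → ℚ) → ℚ
Σᵥ {n} f = foldr (λ i acc → f i + acc) 0ℚ (Data.List.allFin n)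

ΣExcept : {n : ℕ} → Fin n → (Fin n → ℚ) → ℚ
ΣExcept x f = Σᵥ (λ u → if ⌊ u ≟ x ⌋ then 0ℚ else f u)

ℕ→ℚ : ℕ → ℚ
ℕ→ℚ k = (+ k) / 1

½^ : ℕ → ℚ
½^ zero    = 1ℚ
½^ (suc t) = ½ * ½^ t

record Graph (n : ℕ) : Set₁ where
  field
    Adj     : Fin n → Fin n → Set
    sym     : ∀ {u v} → Adj u v → Adj v u
    irrefl  : ∀ {u} → ¬ Adj u u

data Walk {n : ℕ} (G : Graph n) : Fin n → Fin n → ℕ → Set where
  here : ∀ {u} → Walk G u u zero
  step : ∀ {u w v k} → Graph.Adj G u w → Walk G w v k → Walk G u v (suc k)

Connected : {n : ℕ} → Graph n → Set
Connected G = ∀ u v → ∃ λ k → Walk G u v k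

IsDistance : {n : ℕ} → (G : Graph n) → (Fin n → Fin n → ℕ) → Set
IsDistance G d =
  ∀ u v → Walk G u v (d u v) × (∀ k → Walk G u v k → d u v ℕ.≤ k)

-- heavy: ω(v)/ω(V) ≥ 1/2, written multiplicatively
Heavy : {n : ℕ} → (Fin n → ℚ) → Fin n → Set
Heavy ω v = ½ * Σᵥ ω ≤ ω v

IsMedian : {n : ℕ} → (Fin n → Fin n → ℕ) → (Fin n → ℚ) → Fin n → Set
IsMedian d ω q = ∀ v → Σᵥ (λ u → ℕ→ℚ (d u q) * ω u) ≤ Σᵥ (λ u → ℕ→ℚ (d u v) * ω u)

-- reply: nothing = yes-answer, just u = no-answer pointing to neighbor u
Reply : ℕ → Set
Reply n = Maybe (Fin n)

ValidReply : {n : ℕ} → Graph n → Fin n → Reply n → Set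
ValidReply G q nothing  = ⊤
ValidReply G q (just u) = Graph.Adj G q u

Compatible : {n : ℕ} → (Fin n → Fin n → ℕ) → (Fin n → ℚ) → Fin n → Reply n → Fin n → Set
Compatible d ω q nothing  v = v ≡ q
Compatible d ω q (just u) v = ¬ Heavy ω q × (d q u ℕ.+ d u v ≡ d q v)

BayesStep : {n : ℕ} → (Fin n → Fin n → ℕ) → ℚ → (Fin n → ℚ) → Fin n → Reply n → (Fin n → ℚ) → Set
BayesStep d p ω q r ω' =
  ∀ v → (Compatible d ω q r v → ω' v ≡ ω v * (1ℚ - p))
      × (¬ Compatible d ω q r v → ω' v ≡ ω v * p)

module Submission where

-- Call w c-bounded when ω(V) ≤ c or some vertex y has ω(V ∖ {y}) ≤ c/2; one step turns a
-- c-bounded weight into a c/2-bounded one. If the median q is heavy, every reply is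
-- incompatible with all vertices except q, so ω(V ∖ {q}) is multiplied by p ≤ 1/2, and it was
-- at most c/2 because q is a heaviest vertex. Otherwise the compatible weight is at most half
-- of ω(V) (for a yes-answer since q is light, for a no-answer by the median property, as
-- stepping from q towards the neighbour gains exactly the compatible weight and loses at most
-- the rest), so ω(V) at least halves; and ω(V) ≤ c, since a vertex other than the median
-- carries at most half of the weight. Starting from ω₀(V) = 1, ω_τ is 2^-τ-bounded, and
-- either alternative bounds the weight outside a heaviest vertex.

open import Defs
open import Data.Bool using (if_then_else_)
open import Data.Empty using (⊥-elim)
open import Data.Fin using (Fin; zero; suc; _≟_)
import Data.Integer as ℤ
import Data.Integer.Properties as ℤ
import Data.List as List
open import Data.Maybe using (just; nothing)
open import Data.Nat as ℕ using (ℕ; zero; suc)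
import Data.Nat.Properties as ℕ
open import Data.Nat.Coprimality using (1-coprimeTo) renaming (sym to coprime-sym)
open import Data.Product using (_,_; proj₁; proj₂; ∃-syntax)
open import Data.Rational
  using (ℚ; 0ℚ; 1ℚ; ½; _+_; _*_; _-_; -_; _≤_; _<_; mkℚ; *≤*; nonNegative; positive)
open import Data.Rational.Properties hiding (_≟_)
open import Data.Rational.Solver using (module +-*-Solver)
open import Data.Sum using (_⊎_; inj₁; inj₂)
open import Algebra.Bundles using (CommutativeRing)
open import Algebra.Properties.Semiring.Sum (CommutativeRing.semiring +-*-commutativeRing)
  using (sum; sum-cong-≗; ∑-distrib-+; *-distribˡ-sum; sum-replicate-zero)
open import Function using (_∘_; id)
open import Relation.Binary.PropositionalEquality
open import Relation.Nullary using (¬_; Dec; yes; no; ¬?)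
open import Relation.Nullary.Decidable using (⌊_⌋; _×-dec_; from-yes)
open import Relation.Unary using (Pred; Decidable)

open +-*-Solver using (solve; _:=_; _:+_; _:*_; _:-_; con)

p≤q⇒0≤q-p : ∀ {p q} → p ≤ q → 0ℚ ≤ q - p
p≤q⇒0≤q-p {p} {q} p≤q = subst (_≤ q - p) (+-inverseʳ p) (+-monoˡ-≤ (- p) p≤q)

0≤q-p⇒p≤q : ∀ {p q} → 0ℚ ≤ q - p → p ≤ q
0≤q-p⇒p≤q {p} {q} 0≤q-p =
  subst₂ _≤_ (+-identityˡ p) (solve 2 (λ p q → (q :- p) :+ p := q) refl p q) (+-monoˡ-≤ p 0≤q-p)

≤-by-difference : ∀ {p q} r → 0ℚ ≤ r → q - p ≡ r → p ≤ q
≤-by-difference r 0≤r q-p≡r = 0≤q-p⇒p≤q (subst (0ℚ ≤_) (sym q-p≡r) 0≤r)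

0≤p*q : ∀ {p q} → 0ℚ ≤ p → 0ℚ ≤ q → 0ℚ ≤ p * q
0≤p*q {p} {q} 0≤p 0≤q = subst (_≤ p * q) (*-zeroˡ q) (*-monoʳ-≤-nonNeg q {{nonNegative 0≤q}} 0≤p)

0≤½ : 0ℚ ≤ ½
0≤½ = from-yes (0ℚ ≤? ½)

½*-mono-≤ : ∀ {p q} → p ≤ q → ½ * p ≤ ½ * q
½*-mono-≤ = *-monoˡ-≤-nonNeg ½ {{nonNegative 0≤½}}

½*p≤p : ∀ {p} → 0ℚ ≤ p → ½ * p ≤ p
½*p≤p {p} 0≤p = ≤-by-difference (½ * p) (0≤p*q 0≤½ 0≤p)
  (solve 1 (λ p → p :- con ½ :* p := con ½ :* p) refl p)

p+p≤q⇒p≤½q : ∀ {p q} → p + p ≤ q → p ≤ ½ * q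
p+p≤q⇒p≤½q {p} {q} h = ≤-by-difference (½ * (q - (p + p))) (0≤p*q 0≤½ (p≤q⇒0≤q-p h))
  (solve 2 (λ p q → con ½ :* q :- p := con ½ :* (q :- (p :+ p))) refl p q)

+-cancel-≤ : ∀ {a b c e} → a + b ≤ c + e → c ≤ a → b ≤ e
+-cancel-≤ {a} {b} {c} {e} h c≤a = ≤-by-difference ((c + e - (a + b)) + (a - c))
  (+-mono-≤ (p≤q⇒0≤q-p h) (p≤q⇒0≤q-p c≤a))
  (solve 4 (λ a b c e → e :- b := (c :+ e :- (a :+ b)) :+ (a :- c)) refl a b c e)

halves-≤ : ∀ {s c} → s ≤ ½ * s + ½ * c → s ≤ c
halves-≤ {s} {c} h = ≤-by-difference ((½ * s + ½ * c - s) + (½ * s + ½ * c - s))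
  (+-mono-≤ (p≤q⇒0≤q-p h) (p≤q⇒0≤q-p h))
  (solve 2 (λ s c → c :- s := (con ½ :* s :+ con ½ :* c :- s) :+ (con ½ :* s :+ con ½ :* c :- s))
           refl s c)

ℕ→ℚ≡mkℚ : ∀ n → ℕ→ℚ n ≡ mkℚ (ℤ.+ n) 0 (coprime-sym (1-coprimeTo n))
ℕ→ℚ≡mkℚ n = normalize-coprime (coprime-sym (1-coprimeTo n))

ℕ→ℚ-+ : ∀ m n → ℕ→ℚ (m ℕ.+ n) ≡ ℕ→ℚ m + ℕ→ℚ n
ℕ→ℚ-+ m n = begin
  ℤ.+ (m ℕ.+ n) / 1                         ≡⟨ /-cong pos-+ refl ⟩
  (ℤ.+ m ℤ.* ℤ.+ 1 ℤ.+ ℤ.+ n ℤ.* ℤ.+ 1) / 1 ≡⟨ cong₂ _+_ (ℕ→ℚ≡mkℚ m) (ℕ→ℚ≡mkℚ n) ⟨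
  ℕ→ℚ m + ℕ→ℚ n                             ∎
  where
  open ≡-Reasoning
  open Data.Rational using (_/_)
  pos-+ : ℤ.+ (m ℕ.+ n) ≡ ℤ.+ m ℤ.* ℤ.+ 1 ℤ.+ ℤ.+ n ℤ.* ℤ.+ 1
  pos-+ = trans (ℤ.pos-+ m n) (sym (cong₂ ℤ._+_ (ℤ.*-identityʳ (ℤ.+ m)) (ℤ.*-identityʳ (ℤ.+ n))))

ℕ→ℚ-mono-≤ : ∀ {m n} → m ℕ.≤ n → ℕ→ℚ m ≤ ℕ→ℚ n
ℕ→ℚ-mono-≤ {m} {n} m≤n rewrite ℕ→ℚ≡mkℚ m | ℕ→ℚ≡mkℚ n =
  *≤* (subst₂ ℤ._≤_ (sym (ℤ.*-identityʳ (ℤ.+ m))) (sym (ℤ.*-identityʳ (ℤ.+ n))) (ℤ.+≤+ m≤n))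

ℕ→ℚ-suc-* : ∀ k a → ℕ→ℚ (k ℕ.+ 1) * a ≡ ℕ→ℚ k * a + a
ℕ→ℚ-suc-* k a = trans (cong (_* a) (ℕ→ℚ-+ k 1))
  (solve 2 (λ k a → (k :+ con 1ℚ) :* a := k :* a :+ a) refl (ℕ→ℚ k) a)

Σᵥ≡sum : ∀ {n} (f : Fin n → ℚ) → Σᵥ f ≡ sum f
Σᵥ≡sum {n} f = foldr-tabulate id
  where
  foldr-tabulate : ∀ {m} (g : Fin m → Fin n) →
                   List.foldr (λ i acc → f i + acc) 0ℚ (List.tabulate g) ≡ sum (f ∘ g)
  foldr-tabulate {zero}  g = refl
  foldr-tabulate {suc m} g = cong (f (g zero) +_) (foldr-tabulate (g ∘ suc))

sum-mono-≤ : ∀ {n} {f g : Fin n → ℚ} → (∀ i → f i ≤ g i) → sum f ≤ sum g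
sum-mono-≤ {zero}  f≤g = ≤-refl
sum-mono-≤ {suc n} f≤g = +-mono-≤ (f≤g zero) (sum-mono-≤ (f≤g ∘ suc))

sum-nonNeg : ∀ {n} {f : Fin n → ℚ} → (∀ i → 0ℚ ≤ f i) → 0ℚ ≤ sum f
sum-nonNeg {n} {f} 0≤f = subst (_≤ sum f) (sum-replicate-zero n) (sum-mono-≤ {f = λ _ → 0ℚ} 0≤f)

restrict : ∀ {n ℓ} {P : Pred (Fin n) ℓ} → Decidable P → (Fin n → ℚ) → Fin n → ℚ
restrict P? w v = if ⌊ P? v ⌋ then w v else 0ℚ

restrict-⊆ : ∀ {n ℓ} {P Q : Pred (Fin n) ℓ} (P? : Decidable P) (Q? : Decidable Q)
             {w : Fin n → ℚ} → (∀ v → 0ℚ ≤ w v) → (∀ {v} → P v → Q v) →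
             ∀ v → restrict P? w v ≤ restrict Q? w v
restrict-⊆ P? Q? 0≤w P⊆Q v with P? v | Q? v
... | yes _  | yes _  = ≤-refl
... | yes Pv | no ¬Qv = ⊥-elim (¬Qv (P⊆Q Pv))
... | no _   | yes _  = 0≤w v
... | no _   | no _   = ≤-refl

without : ∀ {n} → Fin n → (Fin n → ℚ) → Fin n → ℚ
without x w v = if ⌊ v ≟ x ⌋ then 0ℚ else w v

sum-restrict-≡ : ∀ {n} (w : Fin n → ℚ) x → sum (restrict (_≟ x) w) ≡ w x
sum-restrict-≡ {suc n} w zero = trans (cong (w zero +_) (sum-replicate-zero n)) (+-identityʳ (w zero))
sum-restrict-≡ {suc n} w (suc x) =
  trans (+-identityˡ _) (trans (sum-cong-≗ restrict-suc) (sum-restrict-≡ (w ∘ suc) x))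
  where
  restrict-suc : ∀ v → restrict (_≟ suc x) w (suc v) ≡ restrict (_≟ x) (w ∘ suc) v
  restrict-suc v with v ≟ x
  ... | yes _ = refl
  ... | no  _ = refl

sum-without : ∀ {n} (w : Fin n → ℚ) x → sum w ≡ w x + sum (without x w)
sum-without w x = begin
  sum w                                            ≡⟨ sum-cong-≗ split ⟩
  sum (λ v → restrict (_≟ x) w v + without x w v)  ≡⟨ ∑-distrib-+ (restrict (_≟ x) w) (without x w) ⟩
  sum (restrict (_≟ x) w) + sum (without x w)      ≡⟨ cong (_+ sum (without x w)) (sum-restrict-≡ w x) ⟩
  w x + sum (without x w)                          ∎
  where
  open ≡-Reasoning
  split : ∀ v → w v ≡ restrict (_≟ x) w v + without x w v
  split v with v ≟ x
  ... | yes _ = sym (+-identityʳ (w v))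
  ... | no  _ = sym (+-identityˡ (w v))

without-nonNeg : ∀ {n} {w : Fin n → ℚ} → (∀ v → 0ℚ ≤ w v) → ∀ x v → 0ℚ ≤ without x w v
without-nonNeg 0≤w x v with v ≟ x
... | yes _ = ≤-refl
... | no  _ = 0≤w v

≤-sum : ∀ {n} {w : Fin n → ℚ} → (∀ v → 0ℚ ≤ w v) → ∀ x → w x ≤ sum w
≤-sum {w = w} 0≤w x = subst₂ _≤_ (+-identityʳ (w x)) (sym (sum-without w x))
  (+-monoʳ-≤ (w x) (sum-nonNeg (without-nonNeg 0≤w x)))

sum-without≤sum : ∀ {n} {w : Fin n → ℚ} → (∀ v → 0ℚ ≤ w v) → ∀ x → sum (without x w) ≤ sum w
sum-without≤sum {w = w} 0≤w x = subst₂ _≤_ (+-identityˡ _) (sym (sum-without w x))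
  (+-monoˡ-≤ (sum (without x w)) (0≤w x))

≤-sum-without : ∀ {n} {w : Fin n → ℚ} → (∀ v → 0ℚ ≤ w v) →
                ∀ {x y} → ¬ y ≡ x → w y ≤ sum (without x w)
≤-sum-without {w = w} 0≤w {x} {y} y≢x =
  subst (_≤ sum (without x w)) without-y (≤-sum (without-nonNeg 0≤w x) y)
  where
  without-y : without x w y ≡ w y
  without-y with y ≟ x
  ... | yes y≡x = ⊥-elim (y≢x y≡x)
  ... | no  _   = refl

sum-without-antitone : ∀ {n} (w : Fin n → ℚ) {x y} → w y ≤ w x →
                       sum (without x w) ≤ sum (without y w)
sum-without-antitone w {x} {y} wy≤wx =
  +-cancel-≤ (≤-reflexive (trans (sym (sum-without w x)) (sum-without w y))) wy≤wx

module Distance {n} (G : Graph n) {d : Fin n → Fin n → ℕ} (isDistance : IsDistance G d) where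
  open Graph G using (Adj) renaming (sym to Adj-sym; irrefl to Adj-irrefl)

  _++ᵂ_ : ∀ {u v w k m} → Walk G u v k → Walk G v w m → Walk G u w (k ℕ.+ m)
  here       ++ᵂ walk = walk
  step a rest ++ᵂ walk = step a (rest ++ᵂ walk)

  reverse : ∀ {u v k} → Walk G u v k → Walk G v u k
  reverse here = here
  reverse {k = suc k} (step a rest) =
    subst (Walk G _ _) (ℕ.+-comm k 1) (reverse rest ++ᵂ step (Adj-sym a) here)

  shortest : ∀ u v → Walk G u v (d u v)
  shortest u v = proj₁ (isDistance u v)

  d-minimal : ∀ {u v k} → Walk G u v k → d u v ℕ.≤ k
  d-minimal {u} {v} {k} walk = proj₂ (isDistance u v) k walk

  d-triangle : ∀ u v w → d u w ℕ.≤ d u v ℕ.+ d v w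
  d-triangle u v w = d-minimal (shortest u v ++ᵂ shortest v w)

  d-sym : ∀ u v → d u v ≡ d v u
  d-sym u v = ℕ.≤-antisym (d-minimal (reverse (shortest v u))) (d-minimal (reverse (shortest u v)))

  d-refl : ∀ u → d u u ≡ 0
  d-refl u = ℕ.n≤0⇒n≡0 (d-minimal (here {u = u}))

  d≡0⇒≡ : ∀ {u v} → d u v ≡ 0 → u ≡ v
  d≡0⇒≡ {u} {v} d≡0 with d u v | shortest u v
  d≡0⇒≡ refl | zero | here = refl

  Adj⇒d≡1 : ∀ {u v} → Adj u v → d u v ≡ 1
  Adj⇒d≡1 {u} {v} a with d u v in eq | d-minimal (step a here)
  ... | zero          | _ = ⊥-elim (Adj-irrefl (subst (Adj u) (sym (d≡0⇒≡ eq)) a))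
  ... | suc zero      | _ = refl
  ... | suc (suc _)   | ℕ.s≤s ()

  module _ {q u : Fin n} (q~u : Adj q u) where

    d-toward-neighbour : ∀ v → d q u ℕ.+ d u v ≡ d q v → d v u ℕ.+ 1 ≡ d v q
    d-toward-neighbour v on-path rewrite d-sym v u | d-sym v q | Adj⇒d≡1 q~u =
      trans (ℕ.+-comm (d u v) 1) on-path

    d-neighbour-≤ : ∀ v → d v u ℕ.≤ d v q ℕ.+ 1
    d-neighbour-≤ v = subst (λ k → d v u ℕ.≤ d v q ℕ.+ k) (Adj⇒d≡1 q~u) (d-triangle v q u)

module Median {n} (G : Graph n) {d : Fin n → Fin n → ℕ} (isDistance : IsDistance G d)
              {w : Fin n → ℚ} (0≤w : ∀ v → 0ℚ ≤ w v) {q : Fin n} (median : IsMedian d w q) where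
  open Distance G isDistance

  cost : Fin n → ℚ
  cost v = sum (λ x → ℕ→ℚ (d x v) * w x)

  median-exchange : ∀ v (g h : Fin n → ℚ) →
                    (∀ x → ℕ→ℚ (d x v) * w x + g x ≤ ℕ→ℚ (d x q) * w x + h x) → sum g ≤ sum h
  median-exchange v g h pointwise = +-cancel-≤ summed (subst₂ _≤_ (Σᵥ≡sum {n} _) (Σᵥ≡sum {n} _) (median v))
    where
    summed : cost v + sum g ≤ cost q + sum h
    summed = subst₂ _≤_ (∑-distrib-+ (λ x → ℕ→ℚ (d x v) * w x) g)
                        (∑-distrib-+ (λ x → ℕ→ℚ (d x q) * w x) h)
                        (sum-mono-≤ pointwise)

  towards? : (u : Fin n) → Decidable (λ v → d q u ℕ.+ d u v ≡ d q v)
  towards? u v = d q u ℕ.+ d u v ℕ.≟ d q v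

  sum-towards-≤½ : ∀ {u} → Graph.Adj G q u → sum (restrict (towards? u) w) ≤ ½ * sum w
  sum-towards-≤½ {u} q~u =
    p+p≤q⇒p≤½q (subst (_≤ sum w) (∑-distrib-+ T T) (median-exchange u (λ x → T x + T x) w moving))
    where
    T = restrict (towards? u) w
    moving : ∀ x → ℕ→ℚ (d x u) * w x + (T x + T x) ≤ ℕ→ℚ (d x q) * w x + w x
    moving x with towards? u x
    ... | yes on-path = ≤-reflexive (begin
      ℕ→ℚ (d x u) * w x + (w x + w x)   ≡⟨ +-assoc (ℕ→ℚ (d x u) * w x) (w x) (w x) ⟨
      (ℕ→ℚ (d x u) * w x + w x) + w x   ≡⟨ cong (_+ w x) (sym (ℕ→ℚ-suc-* (d x u) (w x))) ⟩
      ℕ→ℚ (d x u ℕ.+ 1) * w x + w x     ≡⟨ cong (λ k → ℕ→ℚ k * w x + w x) (d-toward-neighbour q~u x on-path) ⟩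
      ℕ→ℚ (d x q) * w x + w x           ∎)
      where open ≡-Reasoning
    ... | no _ = begin
      ℕ→ℚ (d x u) * w x + (0ℚ + 0ℚ)     ≡⟨ +-identityʳ _ ⟩
      ℕ→ℚ (d x u) * w x                 ≤⟨ *-monoʳ-≤-nonNeg (w x) {{nonNegative (0≤w x)}}
                                               (ℕ→ℚ-mono-≤ (d-neighbour-≤ q~u x)) ⟩
      ℕ→ℚ (d x q ℕ.+ 1) * w x           ≡⟨ ℕ→ℚ-suc-* (d x q) (w x) ⟩
      ℕ→ℚ (d x q) * w x + w x           ∎
      where open ≤-Reasoning

  ≢median⇒≤½ : ∀ {y} → ¬ q ≡ y → w y ≤ ½ * sum w
  ≢median⇒≤½ {y} q≢y = p+p≤q⇒p≤½q (*-cancelˡ-≤-pos k {{positive 0<k}} k[2wy]≤k[Σw])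
    where
    k = ℕ→ℚ (d q y)
    0<k : 0ℚ < k
    0<k = <-≤-trans (from-yes (0ℚ <? 1ℚ)) (ℕ→ℚ-mono-≤ (ℕ.n≢0⇒n>0 (q≢y ∘ d≡0⇒≡)))
    moving : ∀ x → ℕ→ℚ (d x y) * w x + (k + k) * restrict (_≟ y) w x ≤ ℕ→ℚ (d x q) * w x + k * w x
    moving x with x ≟ y
    ... | yes refl rewrite d-refl x | d-sym x q =
      ≤-reflexive (solve 2 (λ k a → con 0ℚ :* a :+ (k :+ k) :* a := k :* a :+ k :* a) refl k (w x))
    ... | no _ = begin
      ℕ→ℚ (d x y) * w x + (k + k) * 0ℚ    ≡⟨ cong (ℕ→ℚ (d x y) * w x +_) (*-zeroʳ (k + k)) ⟩
      ℕ→ℚ (d x y) * w x + 0ℚ              ≡⟨ +-identityʳ _ ⟩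
      ℕ→ℚ (d x y) * w x                   ≤⟨ *-monoʳ-≤-nonNeg (w x) {{nonNegative (0≤w x)}}
                                                 (ℕ→ℚ-mono-≤ (d-triangle x q y)) ⟩
      ℕ→ℚ (d x q ℕ.+ d q y) * w x         ≡⟨ cong (_* w x) (ℕ→ℚ-+ (d x q) (d q y)) ⟩
      (ℕ→ℚ (d x q) + k) * w x             ≡⟨ *-distribʳ-+ (w x) (ℕ→ℚ (d x q)) k ⟩
      ℕ→ℚ (d x q) * w x + k * w x         ∎
      where open ≤-Reasoning
    k[2wy]≤k[Σw] : k * (w y + w y) ≤ k * sum w
    k[2wy]≤k[Σw] = subst₂ _≤_
      (begin
        sum (λ x → (k + k) * restrict (_≟ y) w x)  ≡⟨ *-distribˡ-sum (k + k) (restrict (_≟ y) w) ⟨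
        (k + k) * sum (restrict (_≟ y) w)          ≡⟨ cong ((k + k) *_) (sum-restrict-≡ w y) ⟩
        (k + k) * w y                              ≡⟨ solve 2 (λ k a → (k :+ k) :* a := k :* (a :+ a)) refl k (w y) ⟩
        k * (w y + w y)                            ∎)
      (sym (*-distribˡ-sum k w))
      (median-exchange y _ _ moving)
      where open ≡-Reasoning

WeightBound : ∀ {n} → (Fin n → ℚ) → ℚ → Set
WeightBound w c = sum w ≤ c ⊎ ∃[ y ] sum (without y w) ≤ ½ * c

WeightBound⇒sum-without-heaviest : ∀ {n} {w : Fin n → ℚ} {c x} → (∀ v → 0ℚ ≤ w v) → 0ℚ ≤ c →
                                   (∀ u → w u ≤ w x) → WeightBound w c → sum (without x w) ≤ c
WeightBound⇒sum-without-heaviest {x = x} 0≤w 0≤c heaviest (inj₁ Σ≤c) =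
  ≤-trans (sum-without≤sum 0≤w x) Σ≤c
WeightBound⇒sum-without-heaviest {w = w} 0≤w 0≤c heaviest (inj₂ (y , Y≤½c)) =
  ≤-trans (sum-without-antitone w (heaviest y)) (≤-trans Y≤½c (½*p≤p 0≤c))

module BayesianSearch {n} (G : Graph n) {d : Fin n → Fin n → ℕ} (isDistance : IsDistance G d)
                      {p : ℚ} (0<p : 0ℚ < p) (p<½ : p < ½) where

  p≤½ : p ≤ ½
  p≤½ = <⇒≤ p<½

  0≤1-p-p : 0ℚ ≤ 1ℚ - p - p
  0≤1-p-p = ≤-by-difference ((½ - p) + (½ - p)) (+-mono-≤ (p≤q⇒0≤q-p p≤½) (p≤q⇒0≤q-p p≤½))
    (solve 1 (λ p → con 1ℚ :- p :- p :- con 0ℚ := (con ½ :- p) :+ (con ½ :- p)) refl p)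

  0≤1-p : 0ℚ ≤ 1ℚ - p
  0≤1-p = p≤q⇒0≤q-p (≤-trans p≤½ (from-yes (½ ≤? 1ℚ)))

  heavy? : ∀ w v → Dec (Heavy {n} w v)
  heavy? w v = ½ * Σᵥ w ≤? w v

  compatible? : ∀ w q r → Decidable (Compatible d w q r)
  compatible? w q nothing  v = v ≟ q
  compatible? w q (just u) v = ¬? (heavy? w q) ×-dec (d q u ℕ.+ d u v ℕ.≟ d q v)

  Heavy⇒½≤ : ∀ {w : Fin n → ℚ} {v} → Heavy w v → ½ * sum w ≤ w v
  Heavy⇒½≤ {w} {v} = subst (λ s → ½ * s ≤ w v) (Σᵥ≡sum w)

  bayes-nonNeg : ∀ {w : Fin n → ℚ} {q r w′} → BayesStep d p w q r w′ →
                 (∀ v → 0ℚ ≤ w v) → ∀ v → 0ℚ ≤ w′ v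
  bayes-nonNeg {w} {q} {r} bayes 0≤w v with compatible? w q r v
  ... | yes c = subst (0ℚ ≤_) (sym (proj₁ (bayes v) c)) (0≤p*q (0≤w v) 0≤1-p)
  ... | no ¬c = subst (0ℚ ≤_) (sym (proj₂ (bayes v) ¬c)) (0≤p*q (0≤w v) (<⇒≤ 0<p))

  module Step {w w′ : Fin n → ℚ} (0≤w : ∀ v → 0ℚ ≤ w v) {q r} (median : IsMedian d w q)
              (valid : ValidReply G q r) (bayes : BayesStep d p w q r w′) where
    open Median G isDistance 0≤w median

    bayes-update : ∀ v → w′ v ≡ p * w v + (1ℚ - p - p) * restrict (compatible? w q r) w v
    bayes-update v with compatible? w q r v
    ... | yes c = trans (proj₁ (bayes v) c)
      (solve 2 (λ a p → a :* (con 1ℚ :- p) := p :* a :+ (con 1ℚ :- p :- p) :* a) refl (w v) p)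
    ... | no ¬c = trans (proj₂ (bayes v) ¬c)
      (solve 2 (λ a p → a :* p := p :* a :+ (con 1ℚ :- p :- p) :* con 0ℚ) refl (w v) p)

    sum-bayes-update : sum w′ ≡ p * sum w + (1ℚ - p - p) * sum (restrict (compatible? w q r) w)
    sum-bayes-update = begin
      sum w′                                                ≡⟨ sum-cong-≗ bayes-update ⟩
      sum (λ v → p * w v + (1ℚ - p - p) * C v)              ≡⟨ ∑-distrib-+ (λ v → p * w v) (λ v → (1ℚ - p - p) * C v) ⟩
      sum (λ v → p * w v) + sum (λ v → (1ℚ - p - p) * C v)  ≡⟨ cong₂ _+_ (*-distribˡ-sum p w) (*-distribˡ-sum (1ℚ - p - p) C) ⟨
      p * sum w + (1ℚ - p - p) * sum C                      ∎
      where
      open ≡-Reasoning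
      C = restrict (compatible? w q r) w

    module _ (heavy : Heavy w q) where

      heavy-sum-without≤½ : sum (without q w) ≤ ½ * sum w
      heavy-sum-without≤½ = +-cancel-≤
        (≤-reflexive (trans (sym (sum-without w q))
                            (solve 1 (λ s → s := con ½ :* s :+ con ½ :* s) refl (sum w))))
        (Heavy⇒½≤ heavy)

      heavy-heaviest : ∀ y → w y ≤ w q
      heavy-heaviest y with y ≟ q
      ... | yes refl = ≤-refl
      ... | no y≢q = ≤-trans (≤-sum-without 0≤w y≢q) (≤-trans heavy-sum-without≤½ (Heavy⇒½≤ heavy))

      heavy-sum-without-update : sum (without q w′) ≡ p * sum (without q w)
      heavy-sum-without-update = trans (sum-cong-≗ scaled) (sym (*-distribˡ-sum p (without q w)))
        where
        incompatible : ∀ r {v} → ¬ v ≡ q → ¬ Compatible d w q r v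
        incompatible nothing  v≢q v≡q        = v≢q v≡q
        incompatible (just u) _   (light , _) = light heavy
        scaled : ∀ v → without q w′ v ≡ p * without q w v
        scaled v with v ≟ q
        ... | yes _  = sym (*-zeroʳ p)
        ... | no v≢q = trans (proj₂ (bayes v) (incompatible r v≢q)) (*-comm (w v) p)

      heavy-step : ∀ {c} → WeightBound w c → WeightBound w′ (½ * c)
      heavy-step {c} bound = inj₂ (q , (begin
        sum (without q w′)  ≡⟨ heavy-sum-without-update ⟩
        p * X               ≤⟨ *-monoʳ-≤-nonNeg X {{nonNegative (sum-nonNeg (without-nonNeg 0≤w q))}} p≤½ ⟩
        ½ * X               ≤⟨ ½*-mono-≤ (X≤½c bound) ⟩
        ½ * (½ * c)         ∎))
        where
        open ≤-Reasoning
        X = sum (without q w)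
        X≤½c : WeightBound w c → X ≤ ½ * c
        X≤½c (inj₁ Σ≤c)       = ≤-trans heavy-sum-without≤½ (½*-mono-≤ Σ≤c)
        X≤½c (inj₂ (y , Y≤½c)) = ≤-trans (sum-without-antitone w (heavy-heaviest y)) Y≤½c

    module _ (light : ¬ Heavy w q) where

      light-<½ : w q < ½ * sum w
      light-<½ = ≰⇒> (light ∘ subst (λ s → ½ * s ≤ w q) (sym (Σᵥ≡sum w)))

      light-sum-compatible≤½ : ∀ r′ → ValidReply G q r′ →
                               sum (restrict (compatible? w q r′) w) ≤ ½ * sum w
      light-sum-compatible≤½ nothing  _   = ≤-trans (≤-reflexive (sum-restrict-≡ w q)) (<⇒≤ light-<½)
      light-sum-compatible≤½ (just u) q~u =
        ≤-trans (sum-mono-≤ (restrict-⊆ (compatible? w q (just u)) (towards? u) 0≤w proj₂))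
                (sum-towards-≤½ q~u)

      light-sum-update≤½ : sum w′ ≤ ½ * sum w
      light-sum-update≤½ = begin
        sum w′                                      ≡⟨ sum-bayes-update ⟩
        p * sum w + (1ℚ - p - p) * sum C            ≤⟨ +-monoʳ-≤ (p * sum w)
                                                         (*-monoˡ-≤-nonNeg (1ℚ - p - p) {{nonNegative 0≤1-p-p}}
                                                           (light-sum-compatible≤½ r valid)) ⟩
        p * sum w + (1ℚ - p - p) * (½ * sum w)      ≡⟨ solve 2 (λ p s → p :* s :+ (con 1ℚ :- p :- p) :* (con ½ :* s) := con ½ :* s)
                                                             refl p (sum w) ⟩
        ½ * sum w                                   ∎
        where
        open ≤-Reasoning
        C = restrict (compatible? w q r) w

      light-≤½ : ∀ y → w y ≤ ½ * sum w
      light-≤½ y with q ≟ y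
      ... | yes refl = <⇒≤ light-<½
      ... | no q≢y   = ≢median⇒≤½ q≢y

      light-step : ∀ {c} → WeightBound w c → WeightBound w′ (½ * c)
      light-step {c} bound = inj₁ (≤-trans light-sum-update≤½ (½*-mono-≤ (sum≤c bound)))
        where
        sum≤c : WeightBound w c → sum w ≤ c
        sum≤c (inj₁ Σ≤c)        = Σ≤c
        sum≤c (inj₂ (y , Y≤½c)) =
          halves-≤ (subst (_≤ ½ * sum w + ½ * c) (sym (sum-without w y)) (+-mono-≤ (light-≤½ y) Y≤½c))

    weightBound-halves : ∀ {c} → WeightBound w c → WeightBound w′ (½ * c)
    weightBound-halves with heavy? w q
    ... | yes heavy = heavy-step heavy
    ... | no light  = light-step light

½^-nonNeg : ∀ t → 0ℚ ≤ ½^ t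
½^-nonNeg zero    = from-yes (0ℚ ≤? 1ℚ)
½^-nonNeg (suc t) = 0≤p*q 0≤½ (½^-nonNeg t)

lemma5 : (n : ℕ) (G : Graph n) → Connected G →
         (d : Fin n → Fin n → ℕ) → IsDistance G d →
         (p : ℚ) → 0ℚ < p → p < ½ →
         (ω : ℕ → Fin n → ℚ) →
         (∀ v → 0ℚ ≤ ω 0 v) → Σᵥ (ω 0) ≡ 1ℚ →
         (q : ℕ → Fin n) → (∀ t → IsMedian d (ω t) (q t)) →
         (r : ℕ → Reply n) → (∀ t → ValidReply G (q t) (r t)) →
         (∀ t → BayesStep d p (ω t) (q t) (r t) (ω (suc t))) →
         ∀ τ (x : Fin n) → (∀ u → ω τ u ≤ ω τ x) →
         ΣExcept x (ω τ) ≤ ½^ τ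
lemma5 n G _ d isDistance p 0<p p<½ ω 0≤ω₀ Σω₀≡1 q median r valid bayes τ x heaviest =
  subst (_≤ ½^ τ) (sym (Σᵥ≡sum (without x (ω τ))))
        (WeightBound⇒sum-without-heaviest (ω-nonNeg τ) (½^-nonNeg τ) heaviest (bound τ))
  where
  open BayesianSearch G isDistance 0<p p<½

  ω-nonNeg : ∀ t v → 0ℚ ≤ ω t v
  ω-nonNeg zero    = 0≤ω₀
  ω-nonNeg (suc t) = bayes-nonNeg (bayes t) (ω-nonNeg t)

  bound : ∀ t → WeightBound (ω t) (½^ t)
  bound zero    = inj₁ (≤-reflexive (trans (sym (Σᵥ≡sum (ω 0))) Σω₀≡1))
  bound (suc t) = Step.weightBound-halves (ω-nonNeg t) (median t) (valid t) (bayes t) (bound t)
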